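{- Let $m\ge 3$, $n\ge 2$, let $C_m$ be the cycle on $m$ vertices and $P_n$ the path on $n$ vertices, and let $\Delta$ be the maximum degree of $C_m\times P_n$. Then $\chi''_{\Sigma}(C_m\times P_n)=\Delta+2$.
   Context: All graphs are finite and simple. A proper total $k$-coloring of a graph $G$ assigns to every vertex and every edge a color from $\{1,\dots,k\}$ such that adjacent vertices receive different colors, edges sharing an endpoint receive different colors, and no edge receives the same color as either of its endpoints. For such a coloring $c$ and a vertex $v$, let $f(v)=c(v)+\sum_{e\ni v} c(e)$. The coloring distinguishes adjacent vertices by sums if $f(u)\neq f(v)$ for every edge $uv$. $\chi''_{\Sigma}(G)$ denotes the smallest $k$ such that $G$ has a proper total $k$-coloring distinguishing adjacent vertices by sums. The product $G_1\times G_2$ is the Cartesian product: vertex set $V(G_1)\times V(G_2)$, with $(u_1,u_2)$ adjacent to $(v_1,v_2)$ iff either $u_1=v_1$ and $u_2v_2\in E(G_2)$, or $u_1v_1\in E(G_1)$ and $u_2=v_2$. -}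

module Defs where

open import Data.Nat using (ℕ; zero; suc; _+_; _*_; _≤_; _⊔_; _≡ᵇ_)
open import Data.Fin using (Fin; toℕ; remQuot)
import Data.Fin as F
open import Data.Bool using (Bool; true; false; _∨_; _∧_; if_then_else_)
open import Data.Product using (_×_; _,_; ∃-syntax)
open import Relation.Binary.PropositionalEquality using (_≡_; _≢_)

-- A finite simple graph on vertex set Fin n, given by a Boolean adjacency
-- function (adjacency 'true' = edge).  The concrete graphs below are
-- symmetric and irreflexive by construction.
Adjacency : ℕ → Set
Adjacency n = Fin n → Fin n → Bool

∑ : (n : ℕ) → (Fin n → ℕ) → ℕ
∑ zero    f = 0
∑ (suc n) f = f F.zero + ∑ n (λ i → f (F.suc i))

maxF : (n : ℕ) → (Fin n → ℕ) → ℕ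
maxF zero    f = 0
maxF (suc n) f = f F.zero ⊔ maxF n (λ i → f (F.suc i))

degree : {n : ℕ} → Adjacency n → Fin n → ℕ
degree {n} adj v = ∑ n (λ u → if adj v u then 1 else 0)

maxDegree : {n : ℕ} → Adjacency n → ℕ
maxDegree {n} adj = maxF n (degree adj)

pathAdj : (n : ℕ) → Adjacency n
pathAdj n i j = (toℕ j ≡ᵇ suc (toℕ i)) ∨ (toℕ i ≡ᵇ suc (toℕ j))

cycleAdj : (m : ℕ) → Adjacency m
cycleAdj m i j = pathAdj m i j
               ∨ ((toℕ i ≡ᵇ 0) ∧ (suc (toℕ j) ≡ᵇ m))
               ∨ ((toℕ j ≡ᵇ 0) ∧ (suc (toℕ i) ≡ᵇ m))

-- Cartesian product G₁ × G₂ on Fin (n₁ * n₂), vertex (a , b) encoded by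
-- Data.Fin.combine a b (decoded by remQuot)
_□_ : {n₁ n₂ : ℕ} → Adjacency n₁ → Adjacency n₂ → Adjacency (n₁ * n₂)
_□_ {n₁} {n₂} adj₁ adj₂ x y with remQuot n₂ x | remQuot n₂ y
... | (u₁ , u₂) | (v₁ , v₂) =
  ((toℕ u₁ ≡ᵇ toℕ v₁) ∧ adj₂ u₂ v₂) ∨ (adj₁ u₁ v₁ ∧ (toℕ u₂ ≡ᵇ toℕ v₂))

-- Edge colours are given by a function on ordered pairs which is
-- required to be symmetric on edges (so it is a colouring of edges).
record SumDistTotalColoring {n : ℕ} (adj : Adjacency n) (k : ℕ) : Set where
  field
    cv : Fin n → ℕ
    ce : Fin n → Fin n → ℕ
    cv-range : ∀ v → 1 ≤ cv v × cv v ≤ k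
    ce-range : ∀ u v → adj u v ≡ true → 1 ≤ ce u v × ce u v ≤ k
    ce-sym   : ∀ u v → adj u v ≡ true → ce u v ≡ ce v u
    vertex-proper : ∀ u v → adj u v ≡ true → cv u ≢ cv v
    edge-proper : ∀ u v w → adj u v ≡ true → adj u w ≡ true → v ≢ w
                  → ce u v ≢ ce u w
    incidence-proper : ∀ u v → adj u v ≡ true → ce u v ≢ cv u × ce u v ≢ cv v

  weight : Fin n → ℕ
  weight v = cv v + ∑ n (λ u → if adj v u then ce v u else 0)

  field
    sum-distinguishing : ∀ u v → adj u v ≡ true → weight u ≢ weight v

χ''Σ-is : {n : ℕ} → Adjacency n → ℕ → Set
χ''Σ-is adj k = SumDistTotalColoring adj k
              × (∀ j → SumDistTotalColoring adj j → k ≤ j)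

-- For n ≥ 2 the maximum degree Δ of C_m × P_n is 3 (n = 2) or 4 (n ≥ 3), and it is attained by two
-- adjacent vertices of one row. Such a vertex sees Δ + 1 pairwise distinct colours (its own and those
-- of its edges); with only Δ + 1 colours available these are 1, …, Δ + 1, so the two vertices get the
-- same weight. Conversely Δ + 2 colours suffice: a vertex and its edges are coloured from finite tables
-- indexed by the types of its column and of the two neighbouring columns and by the context of its
-- row, so every requirement is one of finitely many local conditions on these types, decided by
-- evaluation.

module Submission where

open import Defs
open import Algebra.Properties.CommutativeSemigroup using (interchange)
open import Data.Bool using (Bool; true; false; _∨_; _∧_; if_then_else_; T)
open import Data.Bool.Properties using (∨-zeroʳ; if-∧; T-≡) renaming (_≟_ to _≟ᵇ_)
open import Data.Empty using (⊥; ⊥-elim)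
open import Data.Fin using (Fin; toℕ; remQuot; combine; _↑ˡ_; _↑ʳ_) renaming (zero to fzero; suc to fsuc)
open import Data.Fin.Properties using (toℕ<n; toℕ-fromℕ<; toℕ-injective; remQuot-combine; combine-remQuot)
open import Data.List using (List; []; _∷_; map)
open import Data.List.Membership.Propositional using (_∈_)
open import Data.List.Properties using (map-cong)
open import Data.List.Relation.Unary.All as All using (All; []; _∷_)
import Data.List.Relation.Unary.All.Properties as All
open import Data.List.Relation.Unary.AllPairs using (AllPairs; []; _∷_; allPairs?)
open import Data.List.Relation.Unary.Any using (here; there)
open import Data.Nat
open import Data.Nat.DivMod using (_mod_; m<n⇒m%n≡m)
open import Data.Nat.ListAction using (sum)
open import Data.Nat.Properties
open import Data.Parity.Base using (Parity; 0ℙ; 1ℙ; _⁻¹) renaming (_+_ to _+ℙ_)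
open import Data.Parity.Properties using (+-homo-+; suc-homo-⁻¹)
open import Data.Product using (Σ; _×_; _,_; proj₁; proj₂)
open import Data.Sum using (_⊎_; inj₁; inj₂)
open import Function using (_∘_; case_of_; Equivalence)
open import Relation.Binary.PropositionalEquality
open import Relation.Nullary using (¬_; Dec; yes; no; ¬?)
open import Relation.Nullary.Decidable using (map′; _×-dec_; _→-dec_; from-yes)

T⇒≡true : ∀ {b} → T b → b ≡ true
T⇒≡true = Equivalence.to T-≡

≡true⇒T : ∀ {b} → b ≡ true → T b
≡true⇒T = Equivalence.from T-≡

≡ᵇ≡true⇒≡ : ∀ {a b} → (a ≡ᵇ b) ≡ true → a ≡ b
≡ᵇ≡true⇒≡ {a} {b} e = ≡ᵇ⇒≡ a b (≡true⇒T e)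

≡⇒≡ᵇ≡true : ∀ {a b} → a ≡ b → (a ≡ᵇ b) ≡ true
≡⇒≡ᵇ≡true {a} {b} e = T⇒≡true (≡⇒≡ᵇ a b e)

≢⇒≡ᵇ≡false : ∀ {a b} → a ≢ b → (a ≡ᵇ b) ≡ false
≢⇒≡ᵇ≡false {a} {b} a≢b with a ≡ᵇ b in e
... | true  = ⊥-elim (a≢b (≡ᵇ≡true⇒≡ e))
... | false = refl

<ᵇ≡true⇒< : ∀ {a b} → (a <ᵇ b) ≡ true → a < b
<ᵇ≡true⇒< {a} {b} e = <ᵇ⇒< a b (≡true⇒T e)

<⇒<ᵇ≡true : ∀ {a b} → a < b → (a <ᵇ b) ≡ true
<⇒<ᵇ≡true a<b = T⇒≡true (<⇒<ᵇ a<b)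

∨≡true⇒⊎ : ∀ a {b} → a ∨ b ≡ true → a ≡ true ⊎ b ≡ true
∨≡true⇒⊎ true  _ = inj₁ refl
∨≡true⇒⊎ false e = inj₂ e

∨-intro₁ : ∀ {a} b → a ≡ true → a ∨ b ≡ true
∨-intro₁ b refl = refl

∨-intro₂ : ∀ a {b} → b ≡ true → a ∨ b ≡ true
∨-intro₂ a refl = ∨-zeroʳ a

∧≡true⇒× : ∀ a {b} → a ∧ b ≡ true → a ≡ true × b ≡ true
∧≡true⇒× true e = refl , e

∧-intro : ∀ {a b} → a ≡ true → b ≡ true → a ∧ b ≡ true
∧-intro refl b≡true = b≡true

≡ᵇ-refl : ∀ a → (a ≡ᵇ a) ≡ true
≡ᵇ-refl a = ≡⇒≡ᵇ≡true {a} refl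

≡ᵇ-comm : ∀ a b → (a ≡ᵇ b) ≡ (b ≡ᵇ a)
≡ᵇ-comm zero    zero    = refl
≡ᵇ-comm zero    (suc b) = refl
≡ᵇ-comm (suc a) zero    = refl
≡ᵇ-comm (suc a) (suc b) = ≡ᵇ-comm a b

≡true-ext : ∀ {a b} → (a ≡ true → b ≡ true) → (b ≡ true → a ≡ true) → a ≡ b
≡true-ext {true}  {true}  _ _ = refl
≡true-ext {true}  {false} f _ = sym (f refl)
≡true-ext {false} {true}  _ g = g refl
≡true-ext {false} {false} _ _ = refl

if-true : ∀ {A : Set} {b} {x y : A} → b ≡ true → (if b then x else y) ≡ x
if-true refl = refl

if-false : ∀ {A : Set} {b} {x y : A} → b ≡ false → (if b then x else y) ≡ y
if-false refl = refl

if-∨-+ : ∀ a b (g : ℕ) → ¬ (a ≡ true × b ≡ true) →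
         (if a ∨ b then g else 0) ≡ (if a then g else 0) + (if b then g else 0)
if-∨-+ true  true  g both = ⊥-elim (both (refl , refl))
if-∨-+ true  false g _    = sym (+-identityʳ g)
if-∨-+ false b     g _    = refl

∑-cong : ∀ k {f g : Fin k → ℕ} → (∀ a → f a ≡ g a) → ∑ k f ≡ ∑ k g
∑-cong zero    f≗g = refl
∑-cong (suc k) f≗g = cong₂ _+_ (f≗g fzero) (∑-cong k (f≗g ∘ fsuc))

∑-zero : ∀ k → ∑ k (λ _ → 0) ≡ 0
∑-zero zero    = refl
∑-zero (suc k) = ∑-zero k

∑-+ : ∀ k (f g : Fin k → ℕ) → ∑ k (λ a → f a + g a) ≡ ∑ k f + ∑ k g
∑-+ zero    f g = refl
∑-+ (suc k) f g = trans (cong (f fzero + g fzero +_) (∑-+ k (f ∘ fsuc) (g ∘ fsuc)))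
                        (interchange +-commutativeSemigroup (f fzero) (g fzero) _ _)

∑-if : ∀ k b (f : Fin k → ℕ) → ∑ k (λ a → if b then f a else 0) ≡ (if b then ∑ k f else 0)
∑-if k true  f = refl
∑-if k false f = ∑-zero k

∑-↑ : ∀ a b (f : Fin (a + b) → ℕ) → ∑ (a + b) f ≡ ∑ a (λ i → f (i ↑ˡ b)) + ∑ b (λ i → f (a ↑ʳ i))
∑-↑ zero    b f = refl
∑-↑ (suc a) b f = trans (cong (f fzero +_) (∑-↑ a b (f ∘ fsuc))) (sym (+-assoc (f fzero) _ _))

∑-combine : ∀ m n (f : Fin (m * n) → ℕ) → ∑ (m * n) f ≡ ∑ m (λ a → ∑ n (λ b → f (combine a b)))
∑-combine zero    n f = refl
∑-combine (suc m) n f =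
  trans (∑-↑ n (m * n) f) (cong (∑ n (λ b → f (b ↑ˡ (m * n))) +_) (∑-combine m n (λ y → f (n ↑ʳ y))))

∑-at : ∀ k p (F : ℕ → ℕ) →
       ∑ k (λ a → if p ≡ᵇ toℕ a then F (toℕ a) else 0) ≡ (if p <ᵇ k then F p else 0)
∑-at zero    p       F = refl
∑-at (suc k) zero    F = trans (cong (F 0 +_) (∑-zero k)) (+-identityʳ (F 0))
∑-at (suc k) (suc p) F = ∑-at k p (F ∘ suc)

∑-at-< : ∀ {k p} (F : ℕ → ℕ) → p < k → ∑ k (λ a → if p ≡ᵇ toℕ a then F (toℕ a) else 0) ≡ F p
∑-at-< {k} {p} F p<k = trans (∑-at k p F) (if-true (<⇒<ᵇ≡true p<k))

∑-at-pred : ∀ k p (F : ℕ → ℕ) → p ≤ k →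
            ∑ k (λ a → if p ≡ᵇ suc (toℕ a) then F (toℕ a) else 0) ≡ (if 0 <ᵇ p then F (pred p) else 0)
∑-at-pred k zero    F _   = ∑-zero k
∑-at-pred k (suc p) F p+1≤k = ∑-at-< F p+1≤k

toℕ-mod : ∀ {k i} .{{_ : NonZero k}} → i < k → toℕ (i mod k) ≡ i
toℕ-mod i<k = trans (toℕ-fromℕ< _) (m<n⇒m%n≡m i<k)

toℕ-mod-toℕ : ∀ {k} .{{_ : NonZero k}} (a : Fin k) → toℕ a mod k ≡ a
toℕ-mod-toℕ a = toℕ-injective (toℕ-mod (toℕ<n a))

next : ℕ → ℕ → ℕ
next m i = if suc i ≡ᵇ m then 0 else suc i

prev : ℕ → ℕ → ℕ
prev m zero    = pred m
prev m (suc i) = i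

data NextView (m i : ℕ) : Set where
  wraps : suc i ≡ m → next m i ≡ 0 → NextView m i
  steps : suc i ≢ m → next m i ≡ suc i → NextView m i

nextView : ∀ m i → NextView m i
nextView m i with suc i ≡ᵇ m in e
... | true  = wraps (≡ᵇ≡true⇒≡ e) (if-true e)
... | false = steps (λ i+1≡m → case trans (sym (≡⇒≡ᵇ≡true i+1≡m)) e of λ ()) (if-false e)

next<m : ∀ {m i} → i < m → next m i < m
next<m {m} {i} i<m with nextView m i
... | wraps _    e = subst (_< m) (sym e) (≤-<-trans z≤n i<m)
... | steps i+1≢m e = subst (_< m) (sym e) (≤∧≢⇒< i<m i+1≢m)

prev<m : ∀ {m i} → i < m → prev m i < m
prev<m {suc m} {zero}  _   = n<1+n m
prev<m {m}     {suc i} i<m = <-trans (n<1+n i) i<m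

next≢self : ∀ {m i} → 2 ≤ m → next m i ≢ i
next≢self {m} {i} m≥2 eq with nextView m i
... | wraps refl e = <-irrefl (cong suc (trans (sym e) eq)) m≥2
... | steps _    e = 1+n≢n (trans (sym e) eq)

prev≢self : ∀ {m i} → 2 ≤ m → prev m i ≢ i
prev≢self {suc (suc m)} {zero}  _ ()
prev≢self {suc zero}    {zero}  (s≤s ()) _
prev≢self {m}           {suc i} _ eq = 1+n≢n (sym eq)

next≢prev : ∀ {m i} → 3 ≤ m → next m i ≢ prev m i
next≢prev {suc (suc (suc m))} {zero}  _   ()
next≢prev {suc zero}          {zero}  (s≤s ()) _
next≢prev {suc (suc zero)}    {zero}  (s≤s (s≤s ())) _
next≢prev {m}                 {suc i} m≥3 eq with nextView m (suc i)
... | wraps refl e = <-irrefl (cong (2 +_) (trans (sym e) eq)) m≥3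
... | steps _    e = <-irrefl (sym (trans (sym e) eq)) (m≤n⇒m≤1+n (n<1+n i))

next-step : ∀ {m i} → suc i < m → next m i ≡ suc i
next-step i+1<m = if-false (≢⇒≡ᵇ≡false (<⇒≢ i+1<m))

prev-next : ∀ {m i} → i < m → prev m (next m i) ≡ i
prev-next {m} {i} _ with nextView m i
... | wraps i+1≡m e = trans (cong (prev m) e) (cong pred (sym i+1≡m))
... | steps _     e = cong (prev m) e

next-prev : ∀ {m i} → i < m → next m (prev m i) ≡ i
next-prev {suc m} {zero}  _   = if-true (≡ᵇ-refl (suc m))
next-prev {m}     {suc i} i<m = next-step i<m

pathAdjᴺ : ℕ → ℕ → Bool
pathAdjᴺ j j′ = (j′ ≡ᵇ suc j) ∨ (j ≡ᵇ suc j′)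

cycleAdjᴺ : ℕ → ℕ → ℕ → Bool
cycleAdjᴺ m i i′ = pathAdjᴺ i i′ ∨ ((i ≡ᵇ 0) ∧ (suc i′ ≡ᵇ m)) ∨ ((i′ ≡ᵇ 0) ∧ (suc i ≡ᵇ m))

gridAdjᴺ : ℕ → ℕ → ℕ → ℕ → ℕ → Bool
gridAdjᴺ m i j i′ j′ = ((i ≡ᵇ i′) ∧ pathAdjᴺ j j′) ∨ (cycleAdjᴺ m i i′ ∧ (j ≡ᵇ j′))

pathAdjᴺ-irrefl : ∀ j → pathAdjᴺ j j ≡ false
pathAdjᴺ-irrefl j = cong₂ _∨_ (≢⇒≡ᵇ≡false {j} (1+n≢n ∘ sym)) (≢⇒≡ᵇ≡false {j} (1+n≢n ∘ sym))

cycleAdjᴺ⇒next⊎prev : ∀ {m i i′} → i′ < m → cycleAdjᴺ m i i′ ≡ true → next m i ≡ i′ ⊎ prev m i ≡ i′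
cycleAdjᴺ⇒next⊎prev {m} {i} {i′} i′<m adj
  with ∨≡true⇒⊎ (pathAdjᴺ i i′) adj
... | inj₁ path with ∨≡true⇒⊎ (i′ ≡ᵇ suc i) path
...   | inj₁ e = let i′≡i+1 = ≡ᵇ≡true⇒≡ e in
                 inj₁ (trans (next-step (subst (_< m) i′≡i+1 i′<m)) (sym i′≡i+1))
...   | inj₂ e with ≡ᵇ≡true⇒≡ {i} {suc i′} e
...     | refl = inj₂ refl
cycleAdjᴺ⇒next⊎prev {m} {i} {i′} i′<m adj | inj₂ wrap
  with ∨≡true⇒⊎ ((i ≡ᵇ 0) ∧ (suc i′ ≡ᵇ m)) wrap
... | inj₁ e with ∧≡true⇒× (i ≡ᵇ 0) e
...   | i≡0 , i′+1≡m with ≡ᵇ≡true⇒≡ {i} {0} i≡0 | ≡ᵇ≡true⇒≡ {suc i′} {m} i′+1≡m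
...     | refl | refl = inj₂ refl
cycleAdjᴺ⇒next⊎prev {m} {i} {i′} i′<m adj | inj₂ wrap | inj₂ e with ∧≡true⇒× (i′ ≡ᵇ 0) e
... | i′≡0 , i+1≡m with ≡ᵇ≡true⇒≡ {i′} {0} i′≡0 | ≡ᵇ≡true⇒≡ {suc i} {m} i+1≡m
...   | refl | refl = inj₁ (if-true (≡ᵇ-refl (suc i)))

next⊎prev⇒cycleAdjᴺ : ∀ {m i i′} → i < m → next m i ≡ i′ ⊎ prev m i ≡ i′ → cycleAdjᴺ m i i′ ≡ true
next⊎prev⇒cycleAdjᴺ {m} {i} _ (inj₁ refl) with nextView m i
... | wraps i+1≡m e rewrite e = ∨-intro₂ (pathAdjᴺ i 0) (∨-intro₂ _ (≡⇒≡ᵇ≡true i+1≡m))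
... | steps _     e rewrite e = ∨-intro₁ _ (∨-intro₁ _ (≡ᵇ-refl (suc i)))
next⊎prev⇒cycleAdjᴺ {suc m} {zero}  _ (inj₂ refl) = ∨-intro₂ (pathAdjᴺ 0 m) (∨-intro₁ _ (≡ᵇ-refl (suc m)))
next⊎prev⇒cycleAdjᴺ {m}     {suc i} _ (inj₂ refl) = ∨-intro₁ _ (∨-intro₂ (i ≡ᵇ suc (suc i)) (≡ᵇ-refl (suc i)))

cycleAdjᴺ-next-prev : ∀ {m i i′} → i < m → i′ < m → cycleAdjᴺ m i i′ ≡ (next m i ≡ᵇ i′) ∨ (prev m i ≡ᵇ i′)
cycleAdjᴺ-next-prev {m} {i} {i′} i<m i′<m = ≡true-ext to from
  where
  to : cycleAdjᴺ m i i′ ≡ true → (next m i ≡ᵇ i′) ∨ (prev m i ≡ᵇ i′) ≡ true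
  to adj with cycleAdjᴺ⇒next⊎prev i′<m adj
  ... | inj₁ e = ∨-intro₁ _ (≡⇒≡ᵇ≡true e)
  ... | inj₂ e = ∨-intro₂ _ (≡⇒≡ᵇ≡true e)
  from : (next m i ≡ᵇ i′) ∨ (prev m i ≡ᵇ i′) ≡ true → cycleAdjᴺ m i i′ ≡ true
  from e with ∨≡true⇒⊎ (next m i ≡ᵇ i′) e
  ... | inj₁ e′ = next⊎prev⇒cycleAdjᴺ i<m (inj₁ (≡ᵇ≡true⇒≡ e′))
  ... | inj₂ e′ = next⊎prev⇒cycleAdjᴺ i<m (inj₂ (≡ᵇ≡true⇒≡ e′))

∑-pathNeighbours : ∀ n j (F : ℕ → ℕ) → j < n →
  ∑ n (λ b → if pathAdjᴺ j (toℕ b) then F (toℕ b) else 0)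
  ≡ (if suc j <ᵇ n then F (suc j) else 0) + (if 0 <ᵇ j then F (pred j) else 0)
∑-pathNeighbours n j F j<n = begin
  ∑ n (λ b → if pathAdjᴺ j (toℕ b) then F (toℕ b) else 0)
    ≡⟨ ∑-cong n (λ b → if-∨-+ _ _ (F (toℕ b)) (not-both (toℕ b))) ⟩
  ∑ n (λ b → (if toℕ b ≡ᵇ suc j then F (toℕ b) else 0) + (if j ≡ᵇ suc (toℕ b) then F (toℕ b) else 0))
    ≡⟨ ∑-+ n _ _ ⟩
  ∑ n (λ b → if toℕ b ≡ᵇ suc j then F (toℕ b) else 0) + ∑ n (λ b → if j ≡ᵇ suc (toℕ b) then F (toℕ b) else 0)
    ≡⟨ cong₂ _+_ (trans (∑-cong n (λ b → cong (λ c → if c then F (toℕ b) else 0) (≡ᵇ-comm (toℕ b) (suc j))))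
                        (∑-at n (suc j) F))
                 (∑-at-pred n j F (<⇒≤ j<n)) ⟩
  (if suc j <ᵇ n then F (suc j) else 0) + (if 0 <ᵇ j then F (pred j) else 0) ∎
  where
  open ≡-Reasoning
  not-both : ∀ j′ → ¬ ((j′ ≡ᵇ suc j) ≡ true × (j ≡ᵇ suc j′) ≡ true)
  not-both j′ (up , down) with ≡ᵇ≡true⇒≡ {j′} up
  ... | refl = <-irrefl (≡ᵇ≡true⇒≡ down) (m≤n⇒m≤1+n (n<1+n j))

∑-cycleNeighbours : ∀ m i (F : ℕ → ℕ) → 3 ≤ m → i < m →
  ∑ m (λ a → if cycleAdjᴺ m i (toℕ a) then F (toℕ a) else 0) ≡ F (next m i) + F (prev m i)
∑-cycleNeighbours m i F m≥3 i<m = begin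
  ∑ m (λ a → if cycleAdjᴺ m i (toℕ a) then F (toℕ a) else 0)
    ≡⟨ ∑-cong m (λ a → trans (cong (λ c → if c then F (toℕ a) else 0) (cycleAdjᴺ-next-prev i<m (toℕ<n a)))
                             (if-∨-+ _ _ (F (toℕ a)) (not-both (toℕ a)))) ⟩
  ∑ m (λ a → (if next m i ≡ᵇ toℕ a then F (toℕ a) else 0) + (if prev m i ≡ᵇ toℕ a then F (toℕ a) else 0))
    ≡⟨ ∑-+ m _ _ ⟩
  ∑ m (λ a → if next m i ≡ᵇ toℕ a then F (toℕ a) else 0) + ∑ m (λ a → if prev m i ≡ᵇ toℕ a then F (toℕ a) else 0)
    ≡⟨ cong₂ _+_ (∑-at-< F (next<m i<m)) (∑-at-< F (prev<m i<m)) ⟩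
  F (next m i) + F (prev m i) ∎
  where
  open ≡-Reasoning
  not-both : ∀ i′ → ¬ ((next m i ≡ᵇ i′) ≡ true × (prev m i ≡ᵇ i′) ≡ true)
  not-both i′ (e , e′) = next≢prev m≥3 (trans (≡ᵇ≡true⇒≡ e) (sym (≡ᵇ≡true⇒≡ e′)))

data Dir : Set where
  up down right left : Dir

allDirs : List Dir
allDirs = up ∷ down ∷ right ∷ left ∷ []

∑ᵈ : (Dir → ℕ) → ℕ
∑ᵈ f = sum (map f allDirs)

onGrid : ℕ → ℕ → Dir → Bool
onGrid n j up    = suc j <ᵇ n
onGrid n j down  = 0 <ᵇ j
onGrid n j right = true
onGrid n j left  = true

shiftᶜ : ℕ → Dir → ℕ → ℕ
shiftᶜ m right i = next m i
shiftᶜ m left  i = prev m i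
shiftᶜ m up    i = i
shiftᶜ m down  i = i

shiftʳ : Dir → ℕ → ℕ
shiftʳ up   j = suc j
shiftʳ down j = pred j
shiftʳ _    j = j

∑-sameColumn : ∀ {m n i j} (F : ℕ → ℕ → ℕ) → i < m → j < n →
  ∑ m (λ a → ∑ n (λ b → if (i ≡ᵇ toℕ a) ∧ pathAdjᴺ j (toℕ b) then F (toℕ a) (toℕ b) else 0))
  ≡ (if suc j <ᵇ n then F i (suc j) else 0) + (if 0 <ᵇ j then F i (pred j) else 0)
∑-sameColumn {m} {n} {i} {j} F i<m j<n = begin
  ∑ m (λ a → ∑ n (λ b → if (i ≡ᵇ toℕ a) ∧ pathAdjᴺ j (toℕ b) then F (toℕ a) (toℕ b) else 0))
    ≡⟨ ∑-cong m (λ a → trans (∑-cong n (λ b → if-∧ (i ≡ᵇ toℕ a))) (∑-if n (i ≡ᵇ toℕ a) _)) ⟩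
  ∑ m (λ a → if i ≡ᵇ toℕ a then ∑ n (λ b → if pathAdjᴺ j (toℕ b) then F (toℕ a) (toℕ b) else 0) else 0)
    ≡⟨ ∑-at-< (λ i′ → ∑ n (λ b → if pathAdjᴺ j (toℕ b) then F i′ (toℕ b) else 0)) i<m ⟩
  ∑ n (λ b → if pathAdjᴺ j (toℕ b) then F i (toℕ b) else 0)
    ≡⟨ ∑-pathNeighbours n j (F i) j<n ⟩
  (if suc j <ᵇ n then F i (suc j) else 0) + (if 0 <ᵇ j then F i (pred j) else 0) ∎
  where open ≡-Reasoning

∑-sameRow : ∀ {m n i j} (F : ℕ → ℕ → ℕ) → 3 ≤ m → i < m → j < n →
  ∑ m (λ a → ∑ n (λ b → if cycleAdjᴺ m i (toℕ a) ∧ (j ≡ᵇ toℕ b) then F (toℕ a) (toℕ b) else 0))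
  ≡ F (next m i) j + F (prev m i) j
∑-sameRow {m} {n} {i} {j} F m≥3 i<m j<n = begin
  ∑ m (λ a → ∑ n (λ b → if cycleAdjᴺ m i (toℕ a) ∧ (j ≡ᵇ toℕ b) then F (toℕ a) (toℕ b) else 0))
    ≡⟨ ∑-cong m (λ a → trans (∑-cong n (λ b → if-∧ (cycleAdjᴺ m i (toℕ a))))
                       (trans (∑-if n (cycleAdjᴺ m i (toℕ a)) _)
                              (cong (λ s → if cycleAdjᴺ m i (toℕ a) then s else 0) (∑-at-< (F (toℕ a)) j<n)))) ⟩
  ∑ m (λ a → if cycleAdjᴺ m i (toℕ a) then F (toℕ a) j else 0)
    ≡⟨ ∑-cycleNeighbours m i (λ i′ → F i′ j) m≥3 i<m ⟩
  F (next m i) j + F (prev m i) j ∎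
  where open ≡-Reasoning

∑-gridNeighbours : ∀ {m n i j} (F : ℕ → ℕ → ℕ) → 3 ≤ m → i < m → j < n →
  ∑ m (λ a → ∑ n (λ b → if gridAdjᴺ m i j (toℕ a) (toℕ b) then F (toℕ a) (toℕ b) else 0))
  ≡ ∑ᵈ (λ d → if onGrid n j d then F (shiftᶜ m d i) (shiftʳ d j) else 0)
∑-gridNeighbours {m} {n} {i} {j} F m≥3 i<m j<n = begin
  ∑ m (λ a → ∑ n (λ b → if gridAdjᴺ m i j (toℕ a) (toℕ b) then F (toℕ a) (toℕ b) else 0))
    ≡⟨ ∑-cong m (λ a → trans (∑-cong n (λ b → if-∨-+ _ _ _ (not-both (toℕ a) (toℕ b)))) (∑-+ n _ _)) ⟩
  ∑ m (λ a → ∑ n (λ b → if (i ≡ᵇ toℕ a) ∧ pathAdjᴺ j (toℕ b) then F (toℕ a) (toℕ b) else 0)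
           + ∑ n (λ b → if cycleAdjᴺ m i (toℕ a) ∧ (j ≡ᵇ toℕ b) then F (toℕ a) (toℕ b) else 0))
    ≡⟨ ∑-+ m _ _ ⟩
  ∑ m (λ a → ∑ n (λ b → if (i ≡ᵇ toℕ a) ∧ pathAdjᴺ j (toℕ b) then F (toℕ a) (toℕ b) else 0))
  + ∑ m (λ a → ∑ n (λ b → if cycleAdjᴺ m i (toℕ a) ∧ (j ≡ᵇ toℕ b) then F (toℕ a) (toℕ b) else 0))
    ≡⟨ cong₂ _+_ (∑-sameColumn F i<m j<n) (∑-sameRow F m≥3 i<m j<n) ⟩
  (above + below) + (F (next m i) j + F (prev m i) j)
    ≡⟨ +-assoc above below _ ⟩
  above + (below + (F (next m i) j + F (prev m i) j))
    ≡⟨ cong (λ t → above + (below + (F (next m i) j + t))) (sym (+-identityʳ (F (prev m i) j))) ⟩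
  ∑ᵈ (λ d → if onGrid n j d then F (shiftᶜ m d i) (shiftʳ d j) else 0) ∎
  where
  open ≡-Reasoning
  above below : ℕ
  above = if suc j <ᵇ n then F i (suc j) else 0
  below = if 0 <ᵇ j then F i (pred j) else 0
  not-both : ∀ i′ j′ → ¬ (((i ≡ᵇ i′) ∧ pathAdjᴺ j j′) ≡ true × (cycleAdjᴺ m i i′ ∧ (j ≡ᵇ j′)) ≡ true)
  not-both i′ j′ (vertical , horizontal) with ≡ᵇ≡true⇒≡ {j} {j′} (proj₂ (∧≡true⇒× _ horizontal))
  ... | refl with trans (sym (proj₂ (∧≡true⇒× _ vertical))) (pathAdjᴺ-irrefl j)
  ...   | ()

InRange : ℕ → ℕ → Set
InRange k v = 1 ≤ v × v ≤ k

module _ {N k} {adj : Adjacency N} (colouring : SumDistTotalColoring adj k) where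
  open SumDistTotalColoring colouring

  colours-at-in-range : ∀ x {ys} → All (λ y → adj x y ≡ true) ys → All (InRange k) (cv x ∷ map (ce x) ys)
  colours-at-in-range x adjs = cv-range x ∷ All.map⁺ (All.map (ce-range x _) adjs)

  colours-at-distinct : ∀ x {ys} → All (λ y → adj x y ≡ true) ys → AllPairs _≢_ ys →
                        AllPairs _≢_ (cv x ∷ map (ce x) ys)
  colours-at-distinct x adjs distinct =
    All.map⁺ (All.map (λ x~y → proj₁ (incidence-proper x _ x~y) ∘ sym) adjs) ∷ edges adjs distinct
    where
    others : ∀ {y zs} → adj x y ≡ true → All (λ z → adj x z ≡ true) zs → All (y ≢_) zs →
             All (ce x y ≢_) (map (ce x) zs)
    others x~y []           []           = []
    others x~y (x~z ∷ adjs) (y≢z ∷ y≢zs) = edge-proper x _ _ x~y x~z y≢z ∷ others x~y adjs y≢zs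
    edges : ∀ {ys} → All (λ y → adj x y ≡ true) ys → AllPairs _≢_ ys → AllPairs _≢_ (map (ce x) ys)
    edges []           []                   = []
    edges (x~y ∷ adjs) (y≢ys ∷ distinct) = others x~y adjs y≢ys ∷ edges adjs distinct

InRange? : ∀ k v → Dec (InRange k v)
InRange? k v = 1 ≤? v ×-dec v ≤? k

Distinct? : ∀ vs → Dec (AllPairs _≢_ vs)
Distinct? = allPairs? (λ u v → ¬? (u ≟ v))

sum-distinct-[1,4] : ∀ {a b c d} → let vs = a ∷ b ∷ c ∷ d ∷ [] in
                     All (InRange 4) vs → AllPairs _≢_ vs → sum vs ≡ 10
sum-distinct-[1,4] rng@(ra ∷ rb ∷ rc ∷ rd ∷ []) =
  check (s≤s (proj₂ ra)) (s≤s (proj₂ rb)) (s≤s (proj₂ rc)) (s≤s (proj₂ rd)) rng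
  where
  check : ∀ {a} → a < 5 → ∀ {b} → b < 5 → ∀ {c} → c < 5 → ∀ {d} → d < 5 → let vs = a ∷ b ∷ c ∷ d ∷ [] in
          All (InRange 4) vs → AllPairs _≢_ vs → sum vs ≡ 10
  check = from-yes (allUpTo? (λ a → allUpTo? (λ b → allUpTo? (λ c → allUpTo? (λ d →
    let vs = a ∷ b ∷ c ∷ d ∷ [] in All.all? (InRange? 4) vs →-dec Distinct? vs →-dec sum vs ≟ 10) 5) 5) 5) 5)

sum-distinct-[1,5] : ∀ {a b c d e} → let vs = a ∷ b ∷ c ∷ d ∷ e ∷ [] in
                     All (InRange 5) vs → AllPairs _≢_ vs → sum vs ≡ 15
sum-distinct-[1,5] rng@(ra ∷ rb ∷ rc ∷ rd ∷ re ∷ []) =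
  check (s≤s (proj₂ ra)) (s≤s (proj₂ rb)) (s≤s (proj₂ rc)) (s≤s (proj₂ rd)) (s≤s (proj₂ re)) rng
  where
  check : ∀ {a} → a < 6 → ∀ {b} → b < 6 → ∀ {c} → c < 6 → ∀ {d} → d < 6 → ∀ {e} → e < 6 →
          let vs = a ∷ b ∷ c ∷ d ∷ e ∷ [] in All (InRange 5) vs → AllPairs _≢_ vs → sum vs ≡ 15
  check = from-yes (allUpTo? (λ a → allUpTo? (λ b → allUpTo? (λ c → allUpTo? (λ d → allUpTo? (λ e →
    let vs = a ∷ b ∷ c ∷ d ∷ e ∷ [] in All.all? (InRange? 5) vs →-dec Distinct? vs →-dec sum vs ≟ 15) 6) 6) 6) 6) 6)

f≤maxF : ∀ k (f : Fin k → ℕ) a → f a ≤ maxF k f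
f≤maxF (suc k) f fzero    = m≤m⊔n _ _
f≤maxF (suc k) f (fsuc a) = ≤-trans (f≤maxF k (f ∘ fsuc) a) (m≤n⊔m _ _)

maxF≤ : ∀ k (f : Fin k → ℕ) {B} → (∀ a → f a ≤ B) → maxF k f ≤ B
maxF≤ zero    f f≤B = z≤n
maxF≤ (suc k) f f≤B = ⊔-lub (f≤B fzero) (maxF≤ k (f ∘ fsuc) (f≤B ∘ fsuc))

rowDegree : ℕ → ℕ → ℕ
rowDegree n j = ∑ᵈ (λ d → if onGrid n j d then 1 else 0)

Δ : ℕ → ℕ
Δ n = if n ≡ᵇ 2 then 3 else 4

rowDegree≤Δ : ∀ {n j} → 2 ≤ n → j < n → rowDegree n j ≤ Δ n
rowDegree≤Δ {1}                 (s≤s ())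
rowDegree≤Δ {2}                 {0} _ _ = ≤-refl
rowDegree≤Δ {2}                 {1} _ _ = ≤-refl
rowDegree≤Δ {2}                 {suc (suc j)} _ (s≤s (s≤s ()))
rowDegree≤Δ {suc (suc (suc n))} {j} _ _ =
  +-mono-≤ (indicator≤1 (suc j <ᵇ 3 + n)) (+-monoˡ-≤ 2 (indicator≤1 (0 <ᵇ j)))
  where
  indicator≤1 : ∀ b → (if b then 1 else 0) ≤ 1
  indicator≤1 true  = ≤-refl
  indicator≤1 false = z≤n

rowDegree-attains-Δ : ∀ {n} → 2 ≤ n → Σ ℕ λ j → j < n × rowDegree n j ≡ Δ n
rowDegree-attains-Δ {1}                 (s≤s ())
rowDegree-attains-Δ {2}                 _ = 0 , s≤s z≤n , refl
rowDegree-attains-Δ {suc (suc (suc n))} _ = 1 , s≤s (s≤s z≤n) , refl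

record Finite (A : Set) : Set where
  field
    elements : List A
    complete : ∀ a → a ∈ elements

∀? : ∀ {A} → Finite A → {P : A → Set} → (∀ a → Dec (P a)) → Dec (∀ a → P a)
∀? fin P? =
  map′ (λ all a → All.lookup all (complete a)) (λ all → All.tabulate (λ {a} _ → all a)) (All.all? P? elements)
  where open Finite fin

data ColumnType : Set where
  c₀ c₁ cX cY cZ : ColumnType

-- bottom′ and top′ are the two rows of C_m × P_2, where only 5 colours are available.
data RowType : Set where
  bottom interior₀ interior₁ top₀ top₁ bottom′ top′ : RowType

-- ctx-B, ctx-I₀, ctx-T₀, … are rows of type bottom, interior₀, top₀, …; a trailing B (T) marks an
-- interior row directly above the bottom row (below the top row).
data RowContext : Set where
  ctx-B ctx-I₁B ctx-I₁BT ctx-I₁ ctx-I₁T ctx-I₀ ctx-I₀T ctx-T₀ ctx-T₁ ctx-B′ ctx-T′ : RowContext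

rowType : RowContext → RowType
rowType ctx-B = bottom
rowType ctx-I₁B = interior₁
rowType ctx-I₁BT = interior₁
rowType ctx-I₁ = interior₁
rowType ctx-I₁T = interior₁
rowType ctx-I₀ = interior₀
rowType ctx-I₀T = interior₀
rowType ctx-T₀ = top₀
rowType ctx-T₁ = top₁
rowType ctx-B′ = bottom′
rowType ctx-T′ = top′

typeBelow : RowContext → RowType
typeBelow ctx-B = bottom
typeBelow ctx-I₁B = bottom
typeBelow ctx-I₁BT = bottom
typeBelow ctx-I₁ = interior₀
typeBelow ctx-I₁T = interior₀
typeBelow ctx-I₀ = interior₁
typeBelow ctx-I₀T = interior₁
typeBelow ctx-T₀ = interior₁
typeBelow ctx-T₁ = interior₀
typeBelow ctx-B′ = bottom
typeBelow ctx-T′ = bottom′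

hasBelow : RowContext → Bool
hasBelow ctx-B = false
hasBelow ctx-I₁B = true
hasBelow ctx-I₁BT = true
hasBelow ctx-I₁ = true
hasBelow ctx-I₁T = true
hasBelow ctx-I₀ = true
hasBelow ctx-I₀T = true
hasBelow ctx-T₀ = true
hasBelow ctx-T₁ = true
hasBelow ctx-B′ = false
hasBelow ctx-T′ = true

hasAbove : RowContext → Bool
hasAbove ctx-B = true
hasAbove ctx-I₁B = true
hasAbove ctx-I₁BT = true
hasAbove ctx-I₁ = true
hasAbove ctx-I₁T = true
hasAbove ctx-I₀ = true
hasAbove ctx-I₀T = true
hasAbove ctx-T₀ = false
hasAbove ctx-T₁ = false
hasAbove ctx-B′ = true
hasAbove ctx-T′ = false

directlyBelow : RowContext → RowContext → Bool
directlyBelow ctx-B ctx-I₁B = true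
directlyBelow ctx-B ctx-I₁BT = true
directlyBelow ctx-I₀ ctx-I₁ = true
directlyBelow ctx-I₀ ctx-I₁T = true
directlyBelow ctx-I₀T ctx-T₁ = true
directlyBelow ctx-I₁ ctx-I₀ = true
directlyBelow ctx-I₁ ctx-I₀T = true
directlyBelow ctx-I₁B ctx-I₀ = true
directlyBelow ctx-I₁B ctx-I₀T = true
directlyBelow ctx-I₁BT ctx-T₀ = true
directlyBelow ctx-I₁T ctx-T₀ = true
directlyBelow ctx-B′ ctx-T′ = true
directlyBelow _ _ = false

colourBound : RowType → ℕ
colourBound bottom′ = 5
colourBound top′ = 5
colourBound _ = 6

consecutive : ColumnType → ColumnType → ColumnType → Bool
consecutive c₁ c₀ c₁ = true
consecutive c₀ c₁ c₀ = true
consecutive cZ c₀ c₁ = true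
consecutive c₀ c₁ cX = true
consecutive c₁ cX cY = true
consecutive cX cY cZ = true
consecutive cY cZ c₀ = true
consecutive cZ cX cY = true
consecutive cY cZ cX = true
consecutive _ _ _ = false


-- verticalColour T r colours the edge from a row of type r to the row above it, in a column of type T;
-- horizontalColour T T′ r the edge from a column of type T to the next one, of type T′.
vertexColour : ColumnType → RowType → ℕ
vertexColour c₀ bottom = 4
vertexColour c₀ bottom′ = 3
vertexColour c₀ interior₀ = 3
vertexColour c₀ interior₁ = 1
vertexColour c₀ top₀ = 2
vertexColour c₀ top₁ = 1
vertexColour c₀ top′ = 4
vertexColour c₁ bottom = 3
vertexColour c₁ bottom′ = 5
vertexColour c₁ interior₀ = 6
vertexColour c₁ interior₁ = 4
vertexColour c₁ top₀ = 6
vertexColour c₁ top₁ = 3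
vertexColour c₁ top′ = 3
vertexColour cX bottom = 2
vertexColour cX bottom′ = 1
vertexColour cX interior₀ = 1
vertexColour cX interior₁ = 3
vertexColour cX top₀ = 5
vertexColour cX top₁ = 5
vertexColour cX top′ = 4
vertexColour cY bottom = 4
vertexColour cY bottom′ = 5
vertexColour cY interior₀ = 4
vertexColour cY interior₁ = 5
vertexColour cY top₀ = 1
vertexColour cY top₁ = 1
vertexColour cY top′ = 1
vertexColour cZ bottom = 5
vertexColour cZ bottom′ = 4
vertexColour cZ interior₀ = 6
vertexColour cZ interior₁ = 4
vertexColour cZ top₀ = 3
vertexColour cZ top₁ = 4
vertexColour cZ top′ = 3

verticalColour : ColumnType → RowType → ℕ
verticalColour c₀ bottom = 2
verticalColour c₀ bottom′ = 1
verticalColour c₀ interior₀ = 2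
verticalColour c₀ interior₁ = 4
verticalColour c₁ bottom = 2
verticalColour c₁ bottom′ = 1
verticalColour c₁ interior₀ = 2
verticalColour c₁ interior₁ = 3
verticalColour cX bottom = 4
verticalColour cX bottom′ = 2
verticalColour cX interior₀ = 4
verticalColour cX interior₁ = 2
verticalColour cY bottom = 3
verticalColour cY bottom′ = 4
verticalColour cY interior₀ = 3
verticalColour cY interior₁ = 2
verticalColour cZ bottom = 3
verticalColour cZ bottom′ = 1
verticalColour cZ interior₀ = 3
verticalColour cZ interior₁ = 2
verticalColour _ _ = 1

horizontalColour : ColumnType → ColumnType → RowType → ℕ
horizontalColour c₀ c₁ bottom = 1
horizontalColour c₀ c₁ bottom′ = 2
horizontalColour c₀ c₁ interior₀ = 1
horizontalColour c₀ c₁ interior₁ = 6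
horizontalColour c₀ c₁ top₀ = 5
horizontalColour c₀ c₁ top₁ = 4
horizontalColour c₀ c₁ top′ = 2
horizontalColour c₁ c₀ bottom = 6
horizontalColour c₁ c₀ bottom′ = 4
horizontalColour c₁ c₀ interior₀ = 5
horizontalColour c₁ c₀ interior₁ = 5
horizontalColour c₁ c₀ top₀ = 1
horizontalColour c₁ c₀ top₁ = 5
horizontalColour c₁ c₀ top′ = 5
horizontalColour c₁ cX bottom = 6
horizontalColour c₁ cX bottom′ = 4
horizontalColour c₁ cX interior₀ = 5
horizontalColour c₁ cX interior₁ = 5
horizontalColour c₁ cX top₀ = 1
horizontalColour c₁ cX top₁ = 6
horizontalColour c₁ cX top′ = 5
horizontalColour cX cY bottom = 1
horizontalColour cX cY bottom′ = 3
horizontalColour cX cY interior₀ = 6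
horizontalColour cX cY interior₁ = 1
horizontalColour cX cY top₀ = 6
horizontalColour cX cY top₁ = 2
horizontalColour cX cY top′ = 3
horizontalColour cY cZ bottom = 2
horizontalColour cY cZ bottom′ = 2
horizontalColour cY cZ interior₀ = 1
horizontalColour cY cZ interior₁ = 6
horizontalColour cY cZ top₀ = 4
horizontalColour cY cZ top₁ = 5
horizontalColour cY cZ top′ = 2
horizontalColour cZ c₀ bottom = 6
horizontalColour cZ c₀ bottom′ = 5
horizontalColour cZ c₀ interior₀ = 5
horizontalColour cZ c₀ interior₁ = 5
horizontalColour cZ c₀ top₀ = 1
horizontalColour cZ c₀ top₁ = 6
horizontalColour cZ c₀ top′ = 5
horizontalColour cZ cX bottom = 6
horizontalColour cZ cX bottom′ = 5
horizontalColour cZ cX interior₀ = 5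
horizontalColour cZ cX interior₁ = 5
horizontalColour cZ cX top₀ = 1
horizontalColour cZ cX top₁ = 6
horizontalColour cZ cX top′ = 5
horizontalColour _ _ _ = 1

hasNeighbour : RowContext → Dir → Bool
hasNeighbour c up    = hasAbove c
hasNeighbour c down  = hasBelow c
hasNeighbour c right = true
hasNeighbour c left  = true

edgeColour : ColumnType → ColumnType → ColumnType → RowContext → Dir → ℕ
edgeColour L T R c up    = verticalColour T (rowType c)
edgeColour L T R c down  = verticalColour T (typeBelow c)
edgeColour L T R c right = horizontalColour T R (rowType c)
edgeColour L T R c left  = horizontalColour L T (rowType c)

gadgetWeight : ColumnType → ColumnType → ColumnType → RowContext → ℕ
gadgetWeight L T R c = vertexColour T (rowType c) + ∑ᵈ (λ d → if hasNeighbour c d then edgeColour L T R c d else 0)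

columnTypes : Finite ColumnType
columnTypes = record
  { elements = c₀ ∷ c₁ ∷ cX ∷ cY ∷ cZ ∷ []
  ; complete = λ where
      c₀ → here refl
      c₁ → there (here refl)
      cX → there (there (here refl))
      cY → there (there (there (here refl)))
      cZ → there (there (there (there (here refl))))
  }

rowTypes : Finite RowType
rowTypes = record
  { elements = bottom ∷ interior₀ ∷ interior₁ ∷ top₀ ∷ top₁ ∷ bottom′ ∷ top′ ∷ []
  ; complete = λ where
      bottom    → here refl
      interior₀ → there (here refl)
      interior₁ → there (there (here refl))
      top₀      → there (there (there (here refl)))
      top₁      → there (there (there (there (here refl))))
      bottom′   → there (there (there (there (there (here refl)))))
      top′      → there (there (there (there (there (there (here refl))))))
  }

rowContexts : Finite RowContext
rowContexts = record
  { elements = ctx-B ∷ ctx-I₁B ∷ ctx-I₁BT ∷ ctx-I₁ ∷ ctx-I₁T ∷ ctx-I₀ ∷ ctx-I₀T ∷ ctx-T₀ ∷ ctx-T₁ ∷ ctx-B′ ∷ ctx-T′ ∷ []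
  ; complete = λ where
      ctx-B    → here refl
      ctx-I₁B  → there (here refl)
      ctx-I₁BT → there (there (here refl))
      ctx-I₁   → there (there (there (here refl)))
      ctx-I₁T  → there (there (there (there (here refl))))
      ctx-I₀   → there (there (there (there (there (here refl)))))
      ctx-I₀T  → there (there (there (there (there (there (here refl))))))
      ctx-T₀   → there (there (there (there (there (there (there (here refl)))))))
      ctx-T₁   → there (there (there (there (there (there (there (there (here refl))))))))
      ctx-B′   → there (there (there (there (there (there (there (there (there (here refl)))))))))
      ctx-T′   → there (there (there (there (there (there (there (there (there (there (here refl))))))))))
  }

directions : Finite Dir
directions = record
  { elements = allDirs
  ; complete = λ where
      up    → here refl
      down  → there (here refl)
      right → there (there (here refl))
      left  → there (there (there (here refl)))
  }

_≟ᵈ_ : (d d′ : Dir) → Dec (d ≡ d′)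
up    ≟ᵈ up    = yes refl
up    ≟ᵈ down  = no λ ()
up    ≟ᵈ right = no λ ()
up    ≟ᵈ left  = no λ ()
down  ≟ᵈ up    = no λ ()
down  ≟ᵈ down  = yes refl
down  ≟ᵈ right = no λ ()
down  ≟ᵈ left  = no λ ()
right ≟ᵈ up    = no λ ()
right ≟ᵈ down  = no λ ()
right ≟ᵈ right = yes refl
right ≟ᵈ left  = no λ ()
left  ≟ᵈ up    = no λ ()
left  ≟ᵈ down  = no λ ()
left  ≟ᵈ right = no λ ()
left  ≟ᵈ left  = yes refl

directlyBelow-consistent : ∀ c c′ → directlyBelow c c′ ≡ true →
  hasAbove c ≡ true × hasBelow c′ ≡ true × (∀ T → verticalColour T (typeBelow c′) ≡ verticalColour T (rowType c))
directlyBelow-consistent = from-yes (∀? rowContexts λ c → ∀? rowContexts λ c′ → directlyBelow c c′ ≟ᵇ true →-dec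
  (hasAbove c ≟ᵇ true ×-dec hasBelow c′ ≟ᵇ true ×-dec
   ∀? columnTypes λ T → verticalColour T (typeBelow c′) ≟ verticalColour T (rowType c)))

vertexColour-in-range : ∀ T c → InRange (colourBound (rowType c)) (vertexColour T (rowType c))
vertexColour-in-range = from-yes (∀? columnTypes λ T → ∀? rowContexts λ c →
  InRange? (colourBound (rowType c)) (vertexColour T (rowType c)))

edgeColour-in-range : ∀ L T R c d → hasNeighbour c d ≡ true → InRange (colourBound (rowType c)) (edgeColour L T R c d)
edgeColour-in-range = from-yes (∀? columnTypes λ L → ∀? columnTypes λ T → ∀? columnTypes λ R → ∀? rowContexts λ c →
  ∀? directions λ d → hasNeighbour c d ≟ᵇ true →-dec InRange? (colourBound (rowType c)) (edgeColour L T R c d))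

edgeColours-differ : ∀ L T R c d d′ → consecutive L T R ≡ true → hasNeighbour c d ≡ true → hasNeighbour c d′ ≡ true →
                     d ≢ d′ → edgeColour L T R c d ≢ edgeColour L T R c d′
edgeColours-differ = from-yes (∀? columnTypes λ L → ∀? columnTypes λ T → ∀? columnTypes λ R → ∀? rowContexts λ c →
  ∀? directions λ d → ∀? directions λ d′ →
  consecutive L T R ≟ᵇ true →-dec hasNeighbour c d ≟ᵇ true →-dec hasNeighbour c d′ ≟ᵇ true →-dec ¬? (d ≟ᵈ d′) →-dec
  ¬? (edgeColour L T R c d ≟ edgeColour L T R c d′))

edgeColour≢vertexColour : ∀ L T R c d → consecutive L T R ≡ true → hasNeighbour c d ≡ true →
                          edgeColour L T R c d ≢ vertexColour T (rowType c)
edgeColour≢vertexColour = from-yes (∀? columnTypes λ L → ∀? columnTypes λ T → ∀? columnTypes λ R → ∀? rowContexts λ c →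
  ∀? directions λ d → consecutive L T R ≟ᵇ true →-dec hasNeighbour c d ≟ᵇ true →-dec
  ¬? (edgeColour L T R c d ≟ vertexColour T (rowType c)))

vertexColours-differ-horizontally : ∀ L T R r → consecutive L T R ≡ true → vertexColour T r ≢ vertexColour R r
vertexColours-differ-horizontally = from-yes (∀? columnTypes λ L → ∀? columnTypes λ T → ∀? columnTypes λ R →
  ∀? rowTypes λ r → consecutive L T R ≟ᵇ true →-dec ¬? (vertexColour T r ≟ vertexColour R r))

vertexColours-differ-vertically : ∀ T c c′ → directlyBelow c c′ ≡ true →
                                  vertexColour T (rowType c) ≢ vertexColour T (rowType c′)
vertexColours-differ-vertically = from-yes (∀? columnTypes λ T → ∀? rowContexts λ c → ∀? rowContexts λ c′ →
  directlyBelow c c′ ≟ᵇ true →-dec ¬? (vertexColour T (rowType c) ≟ vertexColour T (rowType c′)))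

gadgetWeights-differ-horizontally : ∀ L T R R′ c → consecutive L T R ≡ true → consecutive T R R′ ≡ true →
                                    gadgetWeight L T R c ≢ gadgetWeight T R R′ c
gadgetWeights-differ-horizontally = from-yes (∀? columnTypes λ L → ∀? columnTypes λ T → ∀? columnTypes λ R →
  ∀? columnTypes λ R′ → ∀? rowContexts λ c → consecutive L T R ≟ᵇ true →-dec consecutive T R R′ ≟ᵇ true →-dec
  ¬? (gadgetWeight L T R c ≟ gadgetWeight T R R′ c))

gadgetWeights-differ-vertically : ∀ L T R c c′ → consecutive L T R ≡ true → directlyBelow c c′ ≡ true →
                                  gadgetWeight L T R c ≢ gadgetWeight L T R c′
gadgetWeights-differ-vertically = from-yes (∀? columnTypes λ L → ∀? columnTypes λ T → ∀? columnTypes λ R →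
  ∀? rowContexts λ c → ∀? rowContexts λ c′ → consecutive L T R ≟ᵇ true →-dec directlyBelow c c′ ≟ᵇ true →-dec
  ¬? (gadgetWeight L T R c ≟ gadgetWeight L T R c′))

alternating : Parity → ColumnType
alternating 0ℙ = c₀
alternating 1ℙ = c₁

-- Arguments: the parities of m and of i, and the number m ∸ suc i of columns after column i.
-- Columns alternate between c₀ and c₁, except that an odd cycle ends with cX cY cZ.
tailType : Parity → Parity → ℕ → ColumnType
tailType _  q (suc (suc (suc _))) = alternating q
tailType 0ℙ q _ = alternating q
tailType 1ℙ _ 2 = cX
tailType 1ℙ _ 1 = cY
tailType 1ℙ _ 0 = cZ

columnType : ℕ → ℕ → ColumnType
columnType m i = tailType (parity m) (parity i) (m ∸ suc i)

columnType-at : ∀ {m i e} → i + suc e ≡ m → columnType m i ≡ tailType (parity m) (parity i) e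
columnType-at {i = i} {e} refl = cong (tailType _ _) (trans (cong (_∸ suc i) (+-suc i e)) (m+n∸m≡n i e))

parity-suc : ∀ n → parity (suc n) ≡ parity n ⁻¹
parity-suc n = sym (suc-homo-⁻¹ (suc n))

tailType-interior : ∀ q e → let p = q +ℙ parity (3 + e) in
                    consecutive (tailType p q (2 + e)) (tailType p (q ⁻¹) (1 + e)) (tailType p q e) ≡ true
tailType-interior 0ℙ 0                   = refl
tailType-interior 0ℙ 1                   = refl
tailType-interior 0ℙ 2                   = refl
tailType-interior 0ℙ (suc (suc (suc e))) = refl
tailType-interior 1ℙ 0                   = refl
tailType-interior 1ℙ 1                   = refl
tailType-interior 1ℙ 2                   = refl
tailType-interior 1ℙ (suc (suc (suc e))) = refl

tailType-first : ∀ e → let p = parity (3 + e) in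
                 consecutive (tailType p (parity e) 0) (tailType p 0ℙ (2 + e)) (tailType p 1ℙ (1 + e)) ≡ true
tailType-first 0 = refl
tailType-first 1 = refl
tailType-first 2 = refl
tailType-first 3 = refl
tailType-first (suc (suc (suc (suc e)))) = tailType-first (suc (suc e))

tailType-last : ∀ e → let p = parity (3 + e) in
                consecutive (tailType p (parity (1 + e)) 1) (tailType p (parity e) 0) (tailType p 0ℙ (2 + e)) ≡ true
tailType-last 0 = refl
tailType-last 1 = refl
tailType-last 2 = refl
tailType-last (suc (suc (suc e))) = tailType-last (suc e)

columnType-consecutive : ∀ {m i} → 3 ≤ m → i < m →
  consecutive (columnType m (prev m i)) (columnType m i) (columnType m (next m i)) ≡ true
columnType-consecutive {suc zero} {zero} (s≤s ()) _
columnType-consecutive {suc (suc zero)} {zero} (s≤s (s≤s ())) _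
columnType-consecutive {suc (suc (suc e))} {zero} _ _
  rewrite columnType-at {suc (suc (suc e))} {suc (suc e)} {0} (+-comm (2 + e) 1) = tailType-first e
columnType-consecutive {suc (suc (suc e))} {suc i} _ i<m with nextView (3 + e) (suc i)
... | wraps refl next≡0
  rewrite next≡0 | columnType-at {3 + e} {suc e} {1} (+-comm (suc e) 2) | columnType-at {3 + e} {2 + e} {0} (+-comm (2 + e) 1)
  = tailType-last e
... | steps i+2≢m next≡i+2 rewrite next≡i+2 =
  interior i (3 + e ∸ (3 + i)) (trans (+-comm-3 i _) (m+[n∸m]≡n (≤∧≢⇒< i<m i+2≢m)))
  where
  +-comm-3 : ∀ a b → a + (3 + b) ≡ 3 + a + b
  +-comm-3 a b = trans (sym (+-assoc a 3 b)) (cong (_+ b) (+-comm a 3))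
  interior : ∀ {m} i e → i + (3 + e) ≡ m →
             consecutive (columnType m i) (columnType m (suc i)) (columnType m (suc (suc i))) ≡ true
  interior {m} i e refl
    rewrite columnType-at {i + (3 + e)} {i} {2 + e} refl
          | columnType-at {i + (3 + e)} {suc i} {1 + e} (sym (+-suc i (2 + e)))
          | columnType-at {i + (3 + e)} {2 + i} {e} (trans (cong suc (sym (+-suc i (1 + e)))) (sym (+-suc i (2 + e))))
          | +-homo-+ i (3 + e) | parity-suc i = tailType-interior (parity i) e

upperContext : Parity → ℕ → RowContext
upperContext 0ℙ 0 = ctx-T₀
upperContext 1ℙ 0 = ctx-T₁
upperContext 0ℙ 1 = ctx-I₀T
upperContext 1ℙ 1 = ctx-I₁T
upperContext 0ℙ (suc (suc _)) = ctx-I₀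
upperContext 1ℙ (suc (suc _)) = ctx-I₁

-- The context of row j when d rows lie above it.
contextAt : ℕ → ℕ → RowContext
contextAt 0 1                   = ctx-B′
contextAt 0 _                   = ctx-B
contextAt 1 0                   = ctx-T′
contextAt 1 1                   = ctx-I₁BT
contextAt 1 (suc (suc _))       = ctx-I₁B
contextAt (suc (suc j)) d       = upperContext (parity j) d

rowContext : ℕ → ℕ → RowContext
rowContext n j = contextAt j (n ∸ suc j)

upperContext-directlyBelow : ∀ p d → directlyBelow (upperContext p (suc d)) (upperContext (p ⁻¹) d) ≡ true
upperContext-directlyBelow 0ℙ 0             = refl
upperContext-directlyBelow 1ℙ 0             = refl
upperContext-directlyBelow 0ℙ 1             = refl
upperContext-directlyBelow 1ℙ 1             = refl
upperContext-directlyBelow 0ℙ (suc (suc d)) = refl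
upperContext-directlyBelow 1ℙ (suc (suc d)) = refl

contextAt-directlyBelow : ∀ j d → directlyBelow (contextAt j (suc d)) (contextAt (suc j) d) ≡ true
contextAt-directlyBelow 0 0                   = refl
contextAt-directlyBelow 0 1                   = refl
contextAt-directlyBelow 0 (suc (suc d))       = refl
contextAt-directlyBelow 1 0                   = refl
contextAt-directlyBelow 1 1                   = refl
contextAt-directlyBelow 1 (suc (suc d))       = refl
contextAt-directlyBelow (suc (suc j)) d rewrite parity-suc j = upperContext-directlyBelow (parity j) d

contextAt-top : ∀ j → hasAbove (contextAt (suc j) 0) ≡ false
contextAt-top 0       = refl
contextAt-top (suc j) with parity j
... | 0ℙ = refl
... | 1ℙ = refl

contextAt-bottom : ∀ d → hasBelow (contextAt 0 d) ≡ false
contextAt-bottom 0             = refl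
contextAt-bottom 1             = refl
contextAt-bottom (suc (suc d)) = refl

upperContext-bound : ∀ p d → colourBound (rowType (upperContext p d)) ≡ 6
upperContext-bound 0ℙ 0             = refl
upperContext-bound 1ℙ 0             = refl
upperContext-bound 0ℙ 1             = refl
upperContext-bound 1ℙ 1             = refl
upperContext-bound 0ℙ (suc (suc d)) = refl
upperContext-bound 1ℙ (suc (suc d)) = refl

contextAt-bound : ∀ j d → colourBound (rowType (contextAt j d)) ≡ Δ (j + suc d) + 2
contextAt-bound 0 0                   = refl
contextAt-bound 0 1                   = refl
contextAt-bound 0 (suc (suc d))       = refl
contextAt-bound 1 0                   = refl
contextAt-bound 1 1                   = refl
contextAt-bound 1 (suc (suc d))       = refl
contextAt-bound (suc (suc j)) d rewrite +-suc j d = upperContext-bound (parity j) d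

<ᵇ-irrefl : ∀ a → (a <ᵇ a) ≡ false
<ᵇ-irrefl zero    = refl
<ᵇ-irrefl (suc a) = <ᵇ-irrefl a

∸-suc : ∀ {m n} → n < m → m ∸ n ≡ suc (m ∸ suc n)
∸-suc {suc m} {zero}  _         = refl
∸-suc {suc m} {suc n} (s≤s n<m) = ∸-suc n<m

rowContext-directlyBelow : ∀ {n j} → suc j < n → directlyBelow (rowContext n j) (rowContext n (suc j)) ≡ true
rowContext-directlyBelow {n} {j} j+1<n rewrite ∸-suc j+1<n = contextAt-directlyBelow j (n ∸ suc (suc j))

rowContext-bound : ∀ {n j} → j < n → colourBound (rowType (rowContext n j)) ≡ Δ n + 2
rowContext-bound {n} {j} j<n =
  trans (contextAt-bound j (n ∸ suc j)) (cong (λ k → Δ k + 2) (trans (+-suc j _) (m+[n∸m]≡n j<n)))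

rowContext-hasNeighbour : ∀ {n j} → 2 ≤ n → j < n → ∀ d → hasNeighbour (rowContext n j) d ≡ onGrid n j d
rowContext-hasNeighbour {n} {j} n≥2 j<n up with m≤n⇒m<n∨m≡n j<n
... | inj₁ j+1<n = trans (proj₁ (directlyBelow-consistent _ _ (rowContext-directlyBelow j+1<n))) (sym (<⇒<ᵇ≡true j+1<n))
... | inj₂ refl = top j n≥2
  where
  top : ∀ j → 2 ≤ suc j → hasAbove (rowContext (suc j) j) ≡ (suc j <ᵇ suc j)
  top zero    (s≤s ())
  top (suc j) _ rewrite n∸n≡0 j | <ᵇ-irrefl j = contextAt-top j
rowContext-hasNeighbour {n} {zero}  n≥2 j<n down = contextAt-bottom (n ∸ 1)
rowContext-hasNeighbour {n} {suc j} n≥2 j<n down =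
  proj₁ (proj₂ (directlyBelow-consistent _ _ (rowContext-directlyBelow j<n)))
rowContext-hasNeighbour n≥2 j<n right = refl
rowContext-hasNeighbour n≥2 j<n left  = refl

module Grid (m n : ℕ) (m≥3 : 3 ≤ m) (n≥2 : 2 ≤ n) where

  instance
    m-nonZero : NonZero m
    m-nonZero = >-nonZero (≤-trans (s≤s z≤n) m≥3)
    n-nonZero : NonZero n
    n-nonZero = >-nonZero (≤-trans (s≤s z≤n) n≥2)

  m≥2 : 2 ≤ m
  m≥2 = ≤-trans (n≤1+n 2) m≥3

  G : Adjacency (m * n)
  G = cycleAdj m □ pathAdj n

  column row : Fin (m * n) → ℕ
  column x = toℕ (proj₁ (remQuot {m} n x))
  row    x = toℕ (proj₂ (remQuot {m} n x))

  column<m : ∀ x → column x < m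
  column<m x = toℕ<n (proj₁ (remQuot {m} n x))

  row<n : ∀ x → row x < n
  row<n x = toℕ<n (proj₂ (remQuot {m} n x))

  cell : ℕ → ℕ → Fin (m * n)
  cell i j = combine (i mod m) (j mod n)

  column-cell : ∀ {i j} → i < m → column (cell i j) ≡ i
  column-cell {i} {j} i<m = trans (cong (toℕ ∘ proj₁) (remQuot-combine (i mod m) (j mod n))) (toℕ-mod i<m)

  row-cell : ∀ {i j} → j < n → row (cell i j) ≡ j
  row-cell {i} {j} j<n = trans (cong (toℕ ∘ proj₂) (remQuot-combine (i mod m) (j mod n))) (toℕ-mod j<n)

  cell-column-row : ∀ x → cell (column x) (row x) ≡ x
  cell-column-row x =
    trans (cong₂ combine (toℕ-mod-toℕ (proj₁ (remQuot {m} n x))) (toℕ-mod-toℕ (proj₂ (remQuot {m} n x))))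
          (combine-remQuot {m} n x)

  ∑-cells : ∀ (f : Fin (m * n) → ℕ) → ∑ (m * n) f ≡ ∑ m (λ a → ∑ n (λ b → f (cell (toℕ a) (toℕ b))))
  ∑-cells f = trans (∑-combine m n f)
                    (∑-cong m (λ a → ∑-cong n (λ b → cong f (sym (cong₂ combine (toℕ-mod-toℕ a) (toℕ-mod-toℕ b))))))

  move : Fin (m * n) → Dir → Fin (m * n)
  move x d = cell (shiftᶜ m d (column x)) (shiftʳ d (row x))

  neighbourSum : ∀ x (g : Fin (m * n) → ℕ) →
    ∑ (m * n) (λ y → if G x y then g y else 0) ≡ ∑ᵈ (λ d → if onGrid n (row x) d then g (move x d) else 0)
  neighbourSum x g = begin
    ∑ (m * n) (λ y → if G x y then g y else 0)
      ≡⟨ ∑-cells _ ⟩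
    ∑ m (λ a → ∑ n (λ b → if G x (cell (toℕ a) (toℕ b)) then g (cell (toℕ a) (toℕ b)) else 0))
      ≡⟨ ∑-cong m (λ a → ∑-cong n (λ b →
           cong (λ c → if c then g (cell (toℕ a) (toℕ b)) else 0)
                (cong₂ (gridAdjᴺ m (column x) (row x)) (column-cell (toℕ<n a)) (row-cell (toℕ<n b))))) ⟩
    ∑ m (λ a → ∑ n (λ b → if gridAdjᴺ m (column x) (row x) (toℕ a) (toℕ b) then g (cell (toℕ a) (toℕ b)) else 0))
      ≡⟨ ∑-gridNeighbours (λ i j → g (cell i j)) m≥3 (column<m x) (row<n x) ⟩
    ∑ᵈ (λ d → if onGrid n (row x) d then g (move x d) else 0) ∎
    where open ≡-Reasoning

  shift-in-range : ∀ {i j} d → onGrid n j d ≡ true → i < m → j < n → shiftᶜ m d i < m × shiftʳ d j < n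
  shift-in-range up    on i<m j<n = i<m , <ᵇ≡true⇒< on
  shift-in-range down  _  i<m j<n = i<m , ≤-<-trans pred[n]≤n j<n
  shift-in-range right _  i<m j<n = next<m i<m , j<n
  shift-in-range left  _  i<m j<n = prev<m i<m , j<n

  module _ x d (on : onGrid n (row x) d ≡ true) where

    column-move : column (move x d) ≡ shiftᶜ m d (column x)
    column-move = column-cell (proj₁ (shift-in-range d on (column<m x) (row<n x)))

    row-move : row (move x d) ≡ shiftʳ d (row x)
    row-move = row-cell (proj₂ (shift-in-range d on (column<m x) (row<n x)))

  ≡move : ∀ {x y} d → column y ≡ shiftᶜ m d (column x) → row y ≡ shiftʳ d (row x) → y ≡ move x d
  ≡move {x} {y} d c r = trans (sym (cell-column-row y)) (cong₂ cell c r)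

  adjacent⇒move : ∀ {x y} → G x y ≡ true → Σ Dir λ d → onGrid n (row x) d ≡ true × y ≡ move x d
  adjacent⇒move {x} {y} adj with ∨≡true⇒⊎ ((column x ≡ᵇ column y) ∧ pathAdjᴺ (row x) (row y)) adj
  ... | inj₁ vertical with ∧≡true⇒× (column x ≡ᵇ column y) vertical
  ...   | same-column , path with ≡ᵇ≡true⇒≡ {column x} same-column | ∨≡true⇒⊎ (row y ≡ᵇ suc (row x)) path
  ...     | c | inj₁ e = let r = ≡ᵇ≡true⇒≡ e in
                         up , <⇒<ᵇ≡true (subst (_< n) r (row<n y)) , ≡move up (sym c) r
  ...     | c | inj₂ e = let r = ≡ᵇ≡true⇒≡ {row x} e in
                         down , cong (0 <ᵇ_) r , ≡move down (sym c) (sym (cong pred r))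
  adjacent⇒move {x} {y} adj | inj₂ horizontal with ∧≡true⇒× (cycleAdjᴺ m (column x) (column y)) horizontal
  ... | cyc , same-row with ≡ᵇ≡true⇒≡ {row x} same-row | cycleAdjᴺ⇒next⊎prev (column<m y) cyc
  ...   | r | inj₁ e = right , refl , ≡move right (sym e) (sym r)
  ...   | r | inj₂ e = left , refl , ≡move left (sym e) (sym r)

  gridAdjᴺ-shift : ∀ {i j} d → onGrid n j d ≡ true → i < m → gridAdjᴺ m i j (shiftᶜ m d i) (shiftʳ d j) ≡ true
  gridAdjᴺ-shift {i} {j}     up    _ _   = ∨-intro₁ _ (∧-intro (≡ᵇ-refl i) (∨-intro₁ _ (≡ᵇ-refl (suc j))))
  gridAdjᴺ-shift {i} {suc j} down  _ _   = ∨-intro₁ _ (∧-intro (≡ᵇ-refl i) (∨-intro₂ _ (≡ᵇ-refl j)))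
  gridAdjᴺ-shift {i} {j}     right _ i<m = ∨-intro₂ _ (∧-intro (next⊎prev⇒cycleAdjᴺ i<m (inj₁ refl)) (≡ᵇ-refl j))
  gridAdjᴺ-shift {i} {j}     left  _ i<m = ∨-intro₂ _ (∧-intro (next⊎prev⇒cycleAdjᴺ i<m (inj₂ refl)) (≡ᵇ-refl j))

  move-adjacent : ∀ x d → onGrid n (row x) d ≡ true → G x (move x d) ≡ true
  move-adjacent x d on =
    trans (cong₂ (gridAdjᴺ m (column x) (row x)) (column-move x d on) (row-move x d on)) (gridAdjᴺ-shift d on (column<m x))

  opposite : Dir → Dir
  opposite up    = down
  opposite down  = up
  opposite right = left
  opposite left  = right

  shiftᶜ-back : ∀ d {i} → i < m → shiftᶜ m (opposite d) (shiftᶜ m d i) ≡ i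
  shiftᶜ-back up    _   = refl
  shiftᶜ-back down  _   = refl
  shiftᶜ-back right i<m = prev-next i<m
  shiftᶜ-back left  i<m = next-prev i<m

  shiftʳ-back : ∀ d {j} → onGrid n j d ≡ true → shiftʳ (opposite d) (shiftʳ d j) ≡ j
  shiftʳ-back up    _ = refl
  shiftʳ-back down  {suc j} _ = refl
  shiftʳ-back right _ = refl
  shiftʳ-back left  _ = refl

  onGrid-back : ∀ d {j} → onGrid n j d ≡ true → j < n → onGrid n (shiftʳ d j) (opposite d) ≡ true
  onGrid-back up    _ _ = refl
  onGrid-back down  {suc j} _ j<n = <⇒<ᵇ≡true j<n
  onGrid-back right _ _ = refl
  onGrid-back left  _ _ = refl

  move-back : ∀ x d → onGrid n (row x) d ≡ true →
              onGrid n (row (move x d)) (opposite d) ≡ true × move (move x d) (opposite d) ≡ x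
  move-back x d on =
    subst (λ r → onGrid n r (opposite d) ≡ true) (sym (row-move x d on)) (onGrid-back d on (row<n x)) ,
    sym (≡move (opposite d)
      (trans (sym (shiftᶜ-back d (column<m x))) (cong (shiftᶜ m (opposite d)) (sym (column-move x d on))))
      (trans (sym (shiftʳ-back d on)) (cong (shiftʳ (opposite d)) (sym (row-move x d on)))))

  shift-injective : ∀ {i j d d′} → onGrid n j d ≡ true →
                    shiftᶜ m d i ≡ shiftᶜ m d′ i → shiftʳ d j ≡ shiftʳ d′ j → d ≡ d′
  shift-injective {d = up}    {up}    _ _ _ = refl
  shift-injective {d = down}  {down}  _ _ _ = refl
  shift-injective {d = right} {right} _ _ _ = refl
  shift-injective {d = left}  {left}  _ _ _ = refl
  shift-injective {d = up}   {down}  _ _ r = ⊥-elim (<-irrefl (sym r) (s≤s pred[n]≤n))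
  shift-injective {d = down} {up}    _ _ r = ⊥-elim (<-irrefl r (s≤s pred[n]≤n))
  shift-injective {d = up}   {right} _ _ r = ⊥-elim (1+n≢n r)
  shift-injective {d = up}   {left}  _ _ r = ⊥-elim (1+n≢n r)
  shift-injective {j = suc j} {down} {right} _ _ r = ⊥-elim (1+n≢n (sym r))
  shift-injective {j = suc j} {down} {left}  _ _ r = ⊥-elim (1+n≢n (sym r))
  shift-injective {d = right} {up}    _ c _ = ⊥-elim (next≢self m≥2 c)
  shift-injective {d = right} {down}  _ c _ = ⊥-elim (next≢self m≥2 c)
  shift-injective {d = right} {left}  _ c _ = ⊥-elim (next≢prev m≥3 c)
  shift-injective {d = left}  {up}    _ c _ = ⊥-elim (prev≢self m≥2 c)
  shift-injective {d = left}  {down}  _ c _ = ⊥-elim (prev≢self m≥2 c)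
  shift-injective {d = left}  {right} _ c _ = ⊥-elim (next≢prev m≥3 (sym c))

  move-injective : ∀ x {d d′} → onGrid n (row x) d ≡ true → onGrid n (row x) d′ ≡ true →
                   move x d ≡ move x d′ → d ≡ d′
  move-injective x {d} {d′} on on′ e =
    shift-injective on (trans (sym (column-move x d on)) (trans (cong column e) (column-move x d′ on′)))
                       (trans (sym (row-move x d on)) (trans (cong row e) (row-move x d′ on′)))

  ∑ᵈ-interior : ∀ {j} (f : Dir → ℕ) → 0 < j → suc j < n →
                ∑ᵈ (λ d → if onGrid n j d then f d else 0) ≡ sum (map f allDirs)
  ∑ᵈ-interior f 0<j j+1<n =
    cong₂ (λ a b → (if a then f up else 0) + ((if b then f down else 0) + sum (map f (right ∷ left ∷ []))))
          (<⇒<ᵇ≡true j+1<n) (<⇒<ᵇ≡true 0<j)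

  ∑ᵈ-bottom : ∀ (f : Dir → ℕ) →
              ∑ᵈ (λ d → if onGrid n 0 d then f d else 0) ≡ sum (map f (up ∷ right ∷ left ∷ []))
  ∑ᵈ-bottom f = cong (λ a → (if a then f up else 0) + sum (map f (right ∷ left ∷ []))) (<⇒<ᵇ≡true n≥2)

  module _ {k} (colouring : SumDistTotalColoring G k) where
    open SumDistTotalColoring colouring

    moves-distinct : ∀ x {ds} → All (λ d → onGrid n (row x) d ≡ true) ds → AllPairs _≢_ ds →
                     AllPairs _≢_ (map (move x) ds)
    moves-distinct x []         []                = []
    moves-distinct x (on ∷ ons) (d≢ds ∷ distinct) = others on ons d≢ds ∷ moves-distinct x ons distinct
      where
      others : ∀ {d es} → onGrid n (row x) d ≡ true → All (λ e → onGrid n (row x) e ≡ true) es → All (d ≢_) es →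
               All (move x d ≢_) (map (move x) es)
      others on []          []           = []
      others on (on′ ∷ ons) (d≢e ∷ d≢es) = (d≢e ∘ move-injective x on on′) ∷ others on ons d≢es

    colours-around : ∀ x {ds} → All (λ d → onGrid n (row x) d ≡ true) ds → AllPairs _≢_ ds →
                     let vs = cv x ∷ map (ce x) (map (move x) ds) in All (InRange k) vs × AllPairs _≢_ vs
    colours-around x {ds} ons distinct =
      colours-at-in-range colouring x adjacent , colours-at-distinct colouring x adjacent (moves-distinct x ons distinct)
      where
      adjacent : All (λ y → G x y ≡ true) (map (move x) ds)
      adjacent = All.map⁺ (All.map (λ {d} → move-adjacent x d) ons)

    bottom-weight : ∀ x → row x ≡ 0 → k ≤ 4 → weight x ≡ 10
    bottom-weight x row≡0 k≤4 = begin
      weight x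
        ≡⟨ cong (cv x +_) (trans (neighbourSum x (ce x))
                          (trans (cong (λ j → ∑ᵈ (λ d → if onGrid n j d then ce x (move x d) else 0)) row≡0)
                                 (∑ᵈ-bottom (ce x ∘ move x)))) ⟩
      sum (cv x ∷ map (ce x) (map (move x) (up ∷ right ∷ left ∷ [])))
        ≡⟨ sum-distinct-[1,4] (All.map (λ (1≤v , v≤k) → 1≤v , ≤-trans v≤k k≤4) (proj₁ around)) (proj₂ around) ⟩
      10 ∎
      where
      open ≡-Reasoning
      vs : List ℕ
      vs = cv x ∷ map (ce x) (map (move x) (up ∷ right ∷ left ∷ []))
      around : All (InRange k) vs × AllPairs _≢_ vs
      around = colours-around x {up ∷ right ∷ left ∷ []}
                 (trans (cong (λ j → suc j <ᵇ n) row≡0) (<⇒<ᵇ≡true n≥2) ∷ refl ∷ refl ∷ [])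
                 (((λ ()) ∷ (λ ()) ∷ []) ∷ ((λ ()) ∷ []) ∷ [] ∷ [])

    interior-weight : ∀ x → 0 < row x → suc (row x) < n → k ≤ 5 → weight x ≡ 15
    interior-weight x 0<j j+1<n k≤5 = begin
      weight x
        ≡⟨ cong (cv x +_) (trans (neighbourSum x (ce x)) (∑ᵈ-interior (ce x ∘ move x) 0<j j+1<n)) ⟩
      sum (cv x ∷ map (ce x) (map (move x) allDirs))
        ≡⟨ sum-distinct-[1,5] (All.map (λ (1≤v , v≤k) → 1≤v , ≤-trans v≤k k≤5) (proj₁ around)) (proj₂ around) ⟩
      15 ∎
      where
      open ≡-Reasoning
      vs : List ℕ
      vs = cv x ∷ map (ce x) (map (move x) allDirs)
      around : All (InRange k) vs × AllPairs _≢_ vs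
      around = colours-around x {allDirs}
                 (<⇒<ᵇ≡true j+1<n ∷ <⇒<ᵇ≡true 0<j ∷ refl ∷ refl ∷ [])
                 (((λ ()) ∷ (λ ()) ∷ (λ ()) ∷ []) ∷ ((λ ()) ∷ (λ ()) ∷ []) ∷ ((λ ()) ∷ []) ∷ [] ∷ [])

    no-colouring-with-4 : k ≤ 4 → ⊥
    no-colouring-with-4 k≤4 =
      sum-distinguishing x y (move-adjacent x right refl) (trans (weight≡10 x row≡0) (sym (weight≡10 y row′≡0)))
      where
      x y : Fin (m * n)
      x = cell 0 0
      y = move x right
      row≡0 : row x ≡ 0
      row≡0 = row-cell (≤-trans (s≤s z≤n) n≥2)
      row′≡0 : row y ≡ 0
      row′≡0 = trans (row-move x right refl) row≡0
      weight≡10 : ∀ z → row z ≡ 0 → weight z ≡ 10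
      weight≡10 z r = bottom-weight z r k≤4

    no-colouring-with-5 : 3 ≤ n → k ≤ 5 → ⊥
    no-colouring-with-5 n≥3 k≤5 =
      sum-distinguishing x y (move-adjacent x right refl) (trans (weight≡15 x row≡1) (sym (weight≡15 y row′≡1)))
      where
      x y : Fin (m * n)
      x = cell 0 1
      y = move x right
      row≡1 : row x ≡ 1
      row≡1 = row-cell n≥2
      row′≡1 : row y ≡ 1
      row′≡1 = trans (row-move x right refl) row≡1
      weight≡15 : ∀ z → row z ≡ 1 → weight z ≡ 15
      weight≡15 z r = interior-weight z (subst (0 <_) (sym r) z<s) (subst (λ j → suc j < n) (sym r) n≥3) k≤5

  degree≡rowDegree : ∀ x → degree G x ≡ rowDegree n (row x)
  degree≡rowDegree x = neighbourSum x (λ _ → 1)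

  maxDegree≡Δ : maxDegree G ≡ Δ n
  maxDegree≡Δ with rowDegree-attains-Δ n≥2
  ... | j , j<n , degree≡Δ = ≤-antisym
    (maxF≤ (m * n) (degree G) (λ x → subst (_≤ Δ n) (sym (degree≡rowDegree x)) (rowDegree≤Δ n≥2 (row<n x))))
    (subst (_≤ maxDegree G) (trans (degree≡rowDegree x) (trans (cong (rowDegree n) (row-cell j<n)) degree≡Δ))
           (f≤maxF (m * n) (degree G) x))
    where
    x : Fin (m * n)
    x = cell 0 j

  G-sym : ∀ {x y} → G x y ≡ true → G y x ≡ true
  G-sym {x} adj with adjacent⇒move adj
  ... | d , on , refl = let on′ , back = move-back x d on in
                        subst (λ z → G (move x d) z ≡ true) back (move-adjacent (move x d) (opposite d) on′)

  adjacency-elim : (P : Fin (m * n) → Fin (m * n) → Set) → (∀ {x y} → P x y → P y x) →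
                   (∀ x → onGrid n (row x) up ≡ true → P x (move x up)) → (∀ x → P x (move x right)) →
                   ∀ {x y} → G x y ≡ true → P x y
  adjacency-elim P P-sym P-up P-right {x} adj with adjacent⇒move adj
  ... | up    , on , refl = P-up x on
  ... | right , on , refl = P-right x
  ... | down  , on , refl = let on′ , back = move-back x down on in P-sym (subst (P (move x down)) back (P-up _ on′))
  ... | left  , on , refl = let _   , back = move-back x left on in P-sym (subst (P (move x left)) back (P-right _))

  module Construction where

    col : ℕ → ColumnType
    col = columnType m

    ctx : ℕ → RowContext
    ctx = rowContext n

    vertexColourAt : ℕ → ℕ → ℕ
    vertexColourAt i j = vertexColour (col i) (rowType (ctx j))

    edgeColourAt : ℕ → ℕ → Dir → ℕ
    edgeColourAt i j = edgeColour (col (prev m i)) (col i) (col (next m i)) (ctx j)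

    gadgetWeightAt : ℕ → ℕ → ℕ
    gadgetWeightAt i j = gadgetWeight (col (prev m i)) (col i) (col (next m i)) (ctx j)

    -- Meaningful on edges only: in the last branch i′ = prev m i.
    edgeColourBetween : ℕ → ℕ → ℕ → ℕ → ℕ
    edgeColourBetween i j i′ j′ =
      if i ≡ᵇ i′ then verticalColour (col i) (rowType (ctx (j ⊓ j′)))
      else if next m i ≡ᵇ i′ then horizontalColour (col i) (col i′) (rowType (ctx j))
      else horizontalColour (col i′) (col i) (rowType (ctx j))

    cv : Fin (m * n) → ℕ
    cv x = vertexColourAt (column x) (row x)

    ce : Fin (m * n) → Fin (m * n) → ℕ
    ce x y = edgeColourBetween (column x) (row x) (column y) (row y)

    consecutive-at : ∀ {i} → i < m → consecutive (col (prev m i)) (col i) (col (next m i)) ≡ true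
    consecutive-at = columnType-consecutive m≥3

    consecutive-right : ∀ {i} → i < m → consecutive (col i) (col (next m i)) (col (next m (next m i))) ≡ true
    consecutive-right {i} i<m = subst (λ k → consecutive (col k) (col (next m i)) (col (next m (next m i))) ≡ true)
                                      (prev-next i<m) (consecutive-at (next<m i<m))

    shared-vertical-edge : ∀ {j} T → suc j < n →
                           verticalColour T (typeBelow (ctx (suc j))) ≡ verticalColour T (rowType (ctx j))
    shared-vertical-edge T j+1<n = proj₂ (proj₂ (directlyBelow-consistent _ _ (rowContext-directlyBelow j+1<n))) T

    edgeColourBetween-shift : ∀ {i j} d → onGrid n j d ≡ true → i < m → j < n →
                              edgeColourBetween i j (shiftᶜ m d i) (shiftʳ d j) ≡ edgeColourAt i j d
    edgeColourBetween-shift {i} {j} up _ _ _ =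
      trans (if-true (≡ᵇ-refl i)) (cong (λ k → verticalColour (col i) (rowType (ctx k))) (m≤n⇒m⊓n≡m (n≤1+n j)))
    edgeColourBetween-shift {i} {suc j} down _ _ j<n =
      trans (if-true (≡ᵇ-refl i)) (trans (cong (λ k → verticalColour (col i) (rowType (ctx k))) (m≥n⇒m⊓n≡n (n≤1+n j)))
                                         (sym (shared-vertical-edge (col i) j<n)))
    edgeColourBetween-shift {i} right _ _ _ =
      trans (if-false (≢⇒≡ᵇ≡false {i} (next≢self {m} m≥2 ∘ sym))) (if-true (≡ᵇ-refl (next m i)))
    edgeColourBetween-shift {i} left  _ i<m _ =
      trans (if-false (≢⇒≡ᵇ≡false {i} (prev≢self {m} m≥2 ∘ sym)))
            (if-false (≢⇒≡ᵇ≡false (next≢prev {m} {i} m≥3)))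

    ce-move : ∀ x d → onGrid n (row x) d ≡ true → ce x (move x d) ≡ edgeColourAt (column x) (row x) d
    ce-move x d on = trans (cong₂ (edgeColourBetween (column x) (row x)) (column-move x d on) (row-move x d on))
                           (edgeColourBetween-shift d on (column<m x) (row<n x))

    edgeColourAt-back : ∀ {i j} d → onGrid n j d ≡ true → i < m → j < n →
                        edgeColourAt (shiftᶜ m d i) (shiftʳ d j) (opposite d) ≡ edgeColourAt i j d
    edgeColourAt-back {i}         up    on _   _   = shared-vertical-edge (col i) (<ᵇ≡true⇒< on)
    edgeColourAt-back {i} {suc j} down  _  _   j<n = sym (shared-vertical-edge (col i) j<n)
    edgeColourAt-back {i} {j}     right _  i<m _   =
      cong (λ k → horizontalColour (col k) (col (next m i)) (rowType (ctx j))) (prev-next i<m)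
    edgeColourAt-back {i} {j}     left  _  i<m _   =
      cong (λ k → horizontalColour (col (prev m i)) (col k) (rowType (ctx j))) (next-prev i<m)

    hasNeighbour-at : ∀ x d → hasNeighbour (ctx (row x)) d ≡ onGrid n (row x) d
    hasNeighbour-at x = rowContext-hasNeighbour n≥2 (row<n x)

    ce-sym : ∀ u v → G u v ≡ true → ce u v ≡ ce v u
    ce-sym u v adj with adjacent⇒move adj
    ... | d , on , refl = begin
      ce u (move u d)
        ≡⟨ ce-move u d on ⟩
      edgeColourAt (column u) (row u) d
        ≡⟨ sym (edgeColourAt-back d on (column<m u) (row<n u)) ⟩
      edgeColourAt (shiftᶜ m d (column u)) (shiftʳ d (row u)) (opposite d)
        ≡⟨ sym (cong₂ (λ i j → edgeColourAt i j (opposite d)) (column-move u d on) (row-move u d on)) ⟩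
      edgeColourAt (column (move u d)) (row (move u d)) (opposite d)
        ≡⟨ sym (ce-move (move u d) (opposite d) on′) ⟩
      ce (move u d) (move (move u d) (opposite d))
        ≡⟨ cong (ce (move u d)) back ⟩
      ce (move u d) u ∎
      where
      open ≡-Reasoning
      on′ : onGrid n (row (move u d)) (opposite d) ≡ true
      on′ = proj₁ (move-back u d on)
      back : move (move u d) (opposite d) ≡ u
      back = proj₂ (move-back u d on)

    weight≡gadgetWeightAt : ∀ x →
      cv x + ∑ (m * n) (λ y → if G x y then ce x y else 0) ≡ gadgetWeightAt (column x) (row x)
    weight≡gadgetWeightAt x = cong (cv x +_) (trans (neighbourSum x (ce x)) (cong sum (map-cong edge allDirs)))
      where
      edge : ∀ d → (if onGrid n (row x) d then ce x (move x d) else 0)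
                   ≡ (if hasNeighbour (ctx (row x)) d then edgeColourAt (column x) (row x) d else 0)
      edge d rewrite hasNeighbour-at x d with onGrid n (row x) d in on
      ... | true  = ce-move x d on
      ... | false = refl

    cv-range : ∀ x → InRange (Δ n + 2) (cv x)
    cv-range x = subst (λ b → InRange b (cv x)) (rowContext-bound (row<n x)) (vertexColour-in-range _ _)

    ce-range : ∀ u v → G u v ≡ true → InRange (Δ n + 2) (ce u v)
    ce-range u v adj with adjacent⇒move adj
    ... | d , on , refl = subst₂ InRange (rowContext-bound (row<n u)) (sym (ce-move u d on))
                                 (edgeColour-in-range _ _ _ _ d (trans (hasNeighbour-at u d) on))

    vertex-proper : ∀ u v → G u v ≡ true → cv u ≢ cv v
    vertex-proper u v = adjacency-elim (λ x y → cv x ≢ cv y) (λ ne → ne ∘ sym) vertical horizontal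
      where
      vertical : ∀ x → onGrid n (row x) up ≡ true → cv x ≢ cv (move x up)
      vertical x on eq = vertexColours-differ-vertically _ _ _ (rowContext-directlyBelow {n} {row x} (<ᵇ≡true⇒< on))
                           (trans eq (cong₂ vertexColourAt (column-move x up on) (row-move x up on)))
      horizontal : ∀ x → cv x ≢ cv (move x right)
      horizontal x eq = vertexColours-differ-horizontally _ _ _ _ (consecutive-at (column<m x))
                          (trans eq (cong₂ vertexColourAt (column-move x right refl) (row-move x right refl)))

    edge-proper : ∀ u v w → G u v ≡ true → G u w ≡ true → v ≢ w → ce u v ≢ ce u w
    edge-proper u v w adj adj′ v≢w with adjacent⇒move adj | adjacent⇒move adj′
    ... | d , on , refl | d′ , on′ , refl with d ≟ᵈ d′
    ...   | yes refl = ⊥-elim (v≢w refl)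
    ...   | no  d≢d′ = λ eq →
      edgeColours-differ _ _ _ _ d d′ (consecutive-at (column<m u)) (trans (hasNeighbour-at u d) on)
                         (trans (hasNeighbour-at u d′) on′) d≢d′ (trans (sym (ce-move u d on)) (trans eq (ce-move u d′ on′)))

    edge≢vertex : ∀ u v → G u v ≡ true → ce u v ≢ cv u
    edge≢vertex u v adj with adjacent⇒move adj
    ... | d , on , refl = λ eq →
      edgeColour≢vertexColour _ _ _ _ d (consecutive-at (column<m u)) (trans (hasNeighbour-at u d) on)
                              (trans (sym (ce-move u d on)) eq)

    gadgetWeights-differ : ∀ u v → G u v ≡ true → gadgetWeightAt (column u) (row u) ≢ gadgetWeightAt (column v) (row v)
    gadgetWeights-differ u v =
      adjacency-elim (λ x y → gadgetWeightAt (column x) (row x) ≢ gadgetWeightAt (column y) (row y)) (λ ne → ne ∘ sym)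
                     vertical horizontal
      where
      vertical : ∀ x → onGrid n (row x) up ≡ true →
                 gadgetWeightAt (column x) (row x) ≢ gadgetWeightAt (column (move x up)) (row (move x up))
      vertical x on eq =
        gadgetWeights-differ-vertically _ _ _ _ _ (consecutive-at (column<m x)) (rowContext-directlyBelow {n} {row x} (<ᵇ≡true⇒< on))
                           (trans eq (cong₂ gadgetWeightAt (column-move x up on) (row-move x up on)))
      horizontal : ∀ x → gadgetWeightAt (column x) (row x) ≢ gadgetWeightAt (column (move x right)) (row (move x right))
      horizontal x eq = gadgetWeights-differ-horizontally _ _ _ _ _ (consecutive-at i<m) (consecutive-right i<m)
        (trans eq (trans (cong₂ gadgetWeightAt (column-move x right refl) (row-move x right refl))
                         (cong (λ k → gadgetWeight (col k) (col (next m i)) (col (next m (next m i))) (ctx (row x))) (prev-next i<m))))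
        where
        i : ℕ
        i = column x
        i<m : i < m
        i<m = column<m x

    colouring : SumDistTotalColoring G (Δ n + 2)
    colouring = record
      { cv                 = cv
      ; ce                 = ce
      ; cv-range           = cv-range
      ; ce-range           = ce-range
      ; ce-sym             = ce-sym
      ; vertex-proper      = vertex-proper
      ; edge-proper        = edge-proper
      ; incidence-proper   = λ u v adj → edge≢vertex u v adj ,
                                         λ eq → edge≢vertex v u (G-sym adj) (trans (sym (ce-sym u v adj)) eq)
      ; sum-distinguishing = λ u v adj eq → gadgetWeights-differ u v adj
                               (trans (sym (weight≡gadgetWeightAt u)) (trans eq (weight≡gadgetWeightAt v)))
      }

lower-bound : ∀ {m n k} → 3 ≤ m → 2 ≤ n → SumDistTotalColoring (cycleAdj m □ pathAdj n) k → Δ n + 2 ≤ k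
lower-bound {n = 1} _ (s≤s ())
lower-bound {m} {2} {k} m≥3 n≥2 colouring with 5 ≤? k
... | yes 5≤k = 5≤k
... | no  5≰k = ⊥-elim (Grid.no-colouring-with-4 m 2 m≥3 n≥2 colouring (≤-pred (≰⇒> 5≰k)))
lower-bound {m} {suc (suc (suc n))} {k} m≥3 n≥2 colouring with 6 ≤? k
... | yes 6≤k = 6≤k
... | no  6≰k =
  ⊥-elim (Grid.no-colouring-with-5 m (3 + n) m≥3 n≥2 colouring (s≤s (s≤s (s≤s z≤n))) (≤-pred (≰⇒> 6≰k)))

theorem4p2 : (m n : ℕ) → 3 ≤ m → 2 ≤ n →
    χ''Σ-is (cycleAdj m □ pathAdj n) (maxDegree (cycleAdj m □ pathAdj n) + 2)
theorem4p2 m n m≥3 n≥2 =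
  subst (λ Δ′ → χ''Σ-is (cycleAdj m □ pathAdj n) (Δ′ + 2)) (sym (Grid.maxDegree≡Δ m n m≥3 n≥2))
        (Grid.Construction.colouring m n m≥3 n≥2 , λ k colouring → lower-bound m≥3 n≥2 colouring)
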